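{- Let $G=(V,E)$ and the algorithm be as described in the context. In a stable configuration, for every $i\in V$ either $PRmarried(i)$ or $PRdead(i)$ holds, where $PRdead(i)\equiv (p_i=null) \text{ and } (\forall j\in N(i): PRmarried(j))$.
   Context: Let $G=(V,E)$ be a finite simple undirected graph; each node is a process and $N(i)$ denotes the set of neighbours of $i$. Each process has an identifier from a totally ordered set; identifiers of any two distinct processes at distance at most $2$ are distinct, and comparisons such as $j>i$ between processes are comparisons of their identifiers. Each process $i$ holds variables $m_i\in\{\text{true},\text{false}\}$ and $p_i\in\{null\}\cup N(i)$; a configuration is an assignment of values to all these variables. Define the predicate $PRmarried(i)\equiv \exists j\in N(i): (p_i=j \text{ and } p_j=i)$. The algorithm consists of the following four guarded rules for each process $i$ (a rule is enabled at $i$ if its guard holds): Update: if $m_i\neq PRmarried(i)$ then $m_i:=PRmarried(i)$. Marriage: if $m_i=PRmarried(i)$ and $p_i=null$ and there is $j\in N(i)$ with $p_j=i$, then $p_i:=j$ (for such a $j$). Seduction: if $m_i=PRmarried(i)$ and $p_i=null$ and $p_k\neq i$ for all $k\in N(i)$ and there is $j\in N(i)$ with $p_j=null$, $j>i$ and $m_j=\text{false}$, then $p_i:=\max\{j\in N(i): p_j=null,\ j>i,\ m_j=\text{false}\}$. Abandonment: if $m_i=PRmarried(i)$ and $p_i=j\neq null$ and $p_j\neq i$ and ($m_j=\text{true}$ or $j\le i$), then $p_i:=null$. A process is eligible if some rule is enabled at it. A configuration is stable if no process is eligible. -}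

module Defs where

open import Data.Nat using (ℕ; _<_; _≤_)
open import Data.Fin using (Fin)
open import Data.Bool using (Bool; true; false)
open import Data.Maybe using (Maybe; just; nothing)
open import Data.Product using (Σ; ∃; _×_; _,_)
open import Data.Sum using (_⊎_)
open import Relation.Nullary using (¬_; Dec)
open import Relation.Binary.PropositionalEquality using (_≡_; _≢_)

record Graph : Set₁ where
  field
    n     : ℕ
    Adj   : Fin n → Fin n → Set
    adj?  : ∀ i j → Dec (Adj i j)
    sym   : ∀ {i j} → Adj i j → Adj j i
    irrefl : ∀ {i} → ¬ Adj i i

record Ids (G : Graph) : Set where
  open Graph G
  field
    ident  : Fin n → ℕ
    dist1  : ∀ {i j} → Adj i j → ident i ≢ ident j
    dist2  : ∀ {i k j} → Adj i k → Adj k j → i ≢ j → ident i ≢ ident j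

module Algorithm (G : Graph) (I : Ids G) where
  open Graph G
  open Ids I

  -- A configuration: m_i ∈ Bool, p_i ∈ {null} ∪ N(i)  (null = nothing).
  record Config : Set where
    field
      m     : Fin n → Bool
      p     : Fin n → Maybe (Fin n)
      p-nbr : ∀ {i j} → p i ≡ just j → Adj i j

  module _ (c : Config) where
    open Config c

    PRmarried : Fin n → Set
    PRmarried i = ∃ λ j → Adj i j × p i ≡ just j × p j ≡ just i

    PRdead : Fin n → Set
    PRdead i = p i ≡ nothing × (∀ j → Adj i j → PRmarried j)

    mAgrees : Fin n → Set
    mAgrees i = (m i ≡ true → PRmarried i) × (PRmarried i → m i ≡ true)

    UpdateGuard : Fin n → Set
    UpdateGuard i = ¬ mAgrees i

    MarriageGuard : Fin n → Set
    MarriageGuard i = mAgrees i × p i ≡ nothing × (∃ λ j → Adj i j × p j ≡ just i)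

    SeductionGuard : Fin n → Set
    SeductionGuard i = mAgrees i × p i ≡ nothing
      × (∀ k → Adj i k → p k ≢ just i)
      × (∃ λ j → Adj i j × p j ≡ nothing × ident i < ident j × m j ≡ false)

    AbandonmentGuard : Fin n → Set
    AbandonmentGuard i = mAgrees i × (∃ λ j → p i ≡ just j × p j ≢ just i
      × (m j ≡ true ⊎ ident j ≤ ident i))

    Eligible : Fin n → Set
    Eligible i = UpdateGuard i ⊎ MarriageGuard i ⊎ SeductionGuard i ⊎ AbandonmentGuard i

    Stable : Set
    Stable = ∀ i → ¬ Eligible i

-- Agreement of every m_i with PRmarried(i) holds in a stable configuration, since Update is
-- disabled. A process x pointing at some y that does not point back must, as Abandonment is
-- disabled at x, have m_y = false and y > x; Marriage being disabled at y forces p_y = z ≠ null,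
-- and m_y = false forces p_z ≠ y. So y is again such a process with a larger identifier, which
-- is impossible among finitely many processes: every pointer is returned. Finally two adjacent
-- processes with null pointers are both unmarried and unpursued, so the smaller one could seduce
-- the larger one.
module Submission where

open import Defs
open import Level using (Level)
open import Data.Nat using (ℕ; zero; suc; _+_; _<_; _≤_; _≤?_; s≤s)
open import Data.Nat.Properties
  using (<⇒≱; <-≤-trans; +-suc; +-monoʳ-≤; m≤m+n; ≰⇒>; <-cmp)
open import Data.Fin using (Fin)
import Data.Fin.Properties as Fin
open import Data.List using (map; allFin)
open import Data.List.Extrema.Nat using (max; xs≤max)
open import Data.List.Membership.Propositional.Properties using (∈-map⁺; ∈-allFin)
import Data.List.Relation.Unary.All as All
open import Data.Bool as Bool using (true; false)
open import Data.Maybe using (just; nothing)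
open import Data.Maybe.Properties using (just-injective; ≡-dec)
open import Data.Product using (∃; _×_; _,_; proj₁; proj₂)
open import Data.Sum using (_⊎_; inj₁; inj₂)
open import Data.Empty using (⊥-elim)
open import Relation.Binary using (tri<; tri≈; tri>)
open import Relation.Nullary using (¬_; Dec; yes; no)
open import Relation.Nullary.Decidable using (_×-dec_; _→-dec_; decidable-stable)
open import Relation.Binary.PropositionalEquality using (_≡_; _≢_; refl; sym; trans; subst)

private
  variable
    a ℓ : Level

module _ {A : Set a} (f : A → ℕ) {B : ℕ} (bounded : ∀ x → f x ≤ B) {P : A → Set ℓ}
         (ascends : ∀ {x} → P x → ∃ λ y → f x < f y × P y) where

  bounded-ascent-impossible : ∀ x → ¬ P x
  bounded-ascent-impossible x = below (suc B) (s≤s (m≤m+n B (f x)))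
    where
    below : ∀ k {x} → B < k + f x → ¬ P x
    below zero    {x} B<fx Px = <⇒≱ B<fx (bounded x)
    below (suc k) {x} B<k+fx Px with ascends Px
    ... | y , fx<fy , Py = below k (<-≤-trans B<k+fx shifted) Py
      where
      shifted : suc k + f x ≤ k + f y
      shifted = subst (_≤ k + f y) (+-suc k (f x)) (+-monoʳ-≤ k fx<fy)

≤-max : ∀ {n} (f : Fin n → ℕ) x → f x ≤ max 0 (map f (allFin n))
≤-max f x = All.lookup (xs≤max 0 (map f _)) (∈-map⁺ f (∈-allFin x))

module _ (G : Graph) (I : Ids G) where
  open Graph G renaming (sym to adj-sym)
  open Ids I
  open Algorithm G I

  module _ (c : Config) where
    open Config c

    points? : ∀ i j → Dec (p i ≡ just j)
    points? i j = ≡-dec Fin._≟_ (p i) (just j)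

    married? : ∀ i → Dec (PRmarried c i)
    married? i with p i in pi
    ... | nothing = no λ { (_ , _ , () , _) }
    ... | just j with points? j i
    ...   | yes pj = yes (j , p-nbr pi , refl , pj)
    ...   | no ¬pj = no λ { (k , _ , pi≡k , pk) →
              ¬pj (subst (λ l → p l ≡ just i) (sym (just-injective pi≡k)) pk) }

    mAgrees? : ∀ i → Dec (mAgrees c i)
    mAgrees? i = ((m i Bool.≟ true) →-dec married? i) ×-dec (married? i →-dec (m i Bool.≟ true))

  module _ {c : Config} (stable : Stable c) where
    open Config c

    agrees : ∀ i → mAgrees c i
    agrees i = decidable-stable (mAgrees? c i) (λ ¬agrees → stable i (inj₁ ¬agrees))

    single⇒m≡false : ∀ {i} → p i ≡ nothing → m i ≡ false
    single⇒m≡false {i} pi with m i in mi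
    ... | false = refl
    ... | true with proj₁ (agrees i) mi
    ...   | _ , _ , pi≡j , _ with trans (sym pi) pi≡j
    ...     | ()

    married⇒m≡true : ∀ {i} → PRmarried c i → m i ≡ true
    married⇒m≡true {i} = proj₂ (agrees i)

    unpursued : ∀ {i} → p i ≡ nothing → ∀ k → Adj i k → p k ≢ just i
    unpursued {i} pi k i~k pk = stable i (inj₂ (inj₁ (agrees i , pi , k , i~k , pk)))

    abandonment-disabled : ∀ {i j} → p i ≡ just j → p j ≢ just i →
                           m j ≡ false × ident i < ident j
    abandonment-disabled {i} {j} pi ¬pj with m j in mj | ident j ≤? ident i
    ... | true  | _       = ⊥-elim (stable i (inj₂ (inj₂ (inj₂ (agrees i , j , pi , ¬pj , inj₁ mj)))))
    ... | false | yes j≤i = ⊥-elim (stable i (inj₂ (inj₂ (inj₂ (agrees i , j , pi , ¬pj , inj₂ j≤i)))))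
    ... | false | no  j≰i = refl , ≰⇒> j≰i

    Unrequited : Fin n → Set
    Unrequited i = ∃ λ j → p i ≡ just j × p j ≢ just i

    unrequited-ascends : ∀ {i} → Unrequited i → ∃ λ j → ident i < ident j × Unrequited j
    unrequited-ascends {i} (j , pi , ¬pj) with abandonment-disabled pi ¬pj | p j in pj
    ... | _ , i<j | nothing =
      ⊥-elim (stable j (inj₂ (inj₁ (agrees j , pj , i , adj-sym (p-nbr pi) , pi))))
    ... | mj , i<j | just k with points? c k j
    ...   | no ¬pk = j , i<j , k , pj , ¬pk
    ...   | yes pk with trans (sym mj) (married⇒m≡true (k , p-nbr pj , pj , pk))
    ...     | ()

    requited : ∀ {i j} → p i ≡ just j → p j ≡ just i
    requited {i} {j} pi = decidable-stable (points? c j i) λ ¬pj →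
      bounded-ascent-impossible ident (≤-max ident) unrequited-ascends i (j , pi , ¬pj)

    pointing⇒married : ∀ {i j} → p i ≡ just j → PRmarried c i
    pointing⇒married {j = j} pi = j , p-nbr pi , pi , requited pi

    seduction-disabled : ∀ {i j} → p i ≡ nothing → Adj i j → p j ≡ nothing → ¬ ident i < ident j
    seduction-disabled {i} {j} pi i~j pj i<j = stable i (inj₂ (inj₂ (inj₁
      (agrees i , pi , unpursued pi , j , i~j , pj , i<j , single⇒m≡false pj))))

    no-adjacent-singles : ∀ {i j} → p i ≡ nothing → Adj i j → ¬ p j ≡ nothing
    no-adjacent-singles {i} {j} pi i~j pj with <-cmp (ident i) (ident j)
    ... | tri< i<j _ _ = seduction-disabled pi i~j pj i<j
    ... | tri≈ _ i≡j _ = dist1 i~j i≡j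
    ... | tri> _ _ j<i = seduction-disabled pj (adj-sym i~j) pi j<i

    married-or-single : ∀ i → PRmarried c i ⊎ p i ≡ nothing
    married-or-single i = by-pointer (p i) refl
      where
      by-pointer : ∀ v → p i ≡ v → PRmarried c i ⊎ p i ≡ nothing
      by-pointer (just _) pi = inj₁ (pointing⇒married pi)
      by-pointer nothing  pi = inj₂ pi

    married-or-dead : ∀ i → PRmarried c i ⊎ PRdead c i
    married-or-dead i with married-or-single i
    ... | inj₁ married = inj₁ married
    ... | inj₂ single  = inj₂ (single , neighbour-married)
      where
      neighbour-married : ∀ j → Adj i j → PRmarried c j
      neighbour-married j i~j with married-or-single j
      ... | inj₁ married = married
      ... | inj₂ single′ = ⊥-elim (no-adjacent-singles single i~j single′)

corollary1 : (G : Graph) (I : Ids G) (c : Algorithm.Config G I) →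
    Algorithm.Stable G I c →
    (i : Fin (Graph.n G)) → Algorithm.PRmarried G I c i ⊎ Algorithm.PRdead G I c i
corollary1 G I c stable = married-or-dead G I {c} stable
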